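{- Let $\mathbf u$ be a standard Sturmian word. Then $inr\mathcal{C}_\mathbf u(n)=n+1$ for infinitely many $n\in\mathbb N$.
   Context: A Sturmian word is a recurrent infinite word over a binary alphabet with exactly $n+1$ factors of length $n$ for every $n$ (these are exactly the binary Arnoux--Rauzy words). It is standard if every prefix is left special, where a factor $w$ is left special if $aw$ and $bw$ are both factors for the two distinct letters $a,b$. Writing $\mathbf u=u_0u_1\cdots$ and $f_n(i)=u_i\cdots u_{i+n-1}$, the initial non-repetitive complexity is $inr\mathcal{C}_\mathbf u(n)=\max\{m\in\mathbb N: f_n(i)\neq f_n(j) \text{ for all } 0\le i<j\le m-1\}$. -}

module Defs where

open import Data.Bool using (Bool; true; false)
open import Data.Nat using (ℕ; zero; suc; _+_; _≤_; _<_)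
open import Data.Fin using (Fin; toℕ)
open import Data.Vec using (Vec; tabulate; _∷_)
open import Data.List using (List; length)
open import Data.List.Relation.Unary.Unique.Propositional using (Unique)
open import Data.List.Membership.Propositional using (_∈_)
open import Data.Product using (Σ; ∃; ∃-syntax; _×_; _,_)
open import Relation.Binary.PropositionalEquality using (_≡_; _≢_)
open import Relation.Nullary using (¬_)

Word : Set
Word = ℕ → Bool

factorAt : Word → (n : ℕ) → ℕ → Vec Bool n
factorAt u n i = tabulate (λ k → u (i + toℕ k))

IsFactor : Word → {n : ℕ} → Vec Bool n → Set
IsFactor u {n} w = ∃[ i ] factorAt u n i ≡ w

Recurrent : Word → Set
Recurrent u = ∀ n i N → ∃[ j ] (N ≤ j × factorAt u n j ≡ factorAt u n i)

HasNFactors : Word → (n k : ℕ) → Set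
HasNFactors u n k =
  Σ (List (Vec Bool n)) λ ws →
    Unique ws × length ws ≡ k × (∀ (w : Vec Bool n) → (w ∈ ws → IsFactor u w) × (IsFactor u w → w ∈ ws))

Sturmian : Word → Set
Sturmian u = Recurrent u × (∀ n → HasNFactors u n (suc n))

LeftSpecial : Word → {n : ℕ} → Vec Bool n → Set
LeftSpecial u w = IsFactor u (false ∷ w) × IsFactor u (true ∷ w)

Standard : Word → Set
Standard u = ∀ n → LeftSpecial u (factorAt u n 0)

DistinctPrefixFactors : Word → (n m : ℕ) → Set
DistinctPrefixFactors u n m = ∀ i j → i < j → j < m → factorAt u n i ≢ factorAt u n j

InrC≡ : Word → (n m : ℕ) → Set
InrC≡ u n m = DistinctPrefixFactors u n m × (∀ m' → DistinctPrefixFactors u n m' → m' ≤ m)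

-- Counting the factors of lengths n and n + 1 shows
--     that there is at most one left special factor of each length, so in a standard
--     Sturmian word the first repetition among f_n(0), f_n(1), ... is a return of the
--     prefix f_n(0).  With the bound inrC(n) ≤ n + 1 coming from the n + 1 factors of
--     length n this gives: inrC(n) = n + 1 as soon as no p ∈ [1, n] is a period of the
--     prefix of length n + p.  Moreover a Sturmian word is not eventually periodic, so
--     a period p breaks at some first position from any given N on.
-- (2) Combinatorics of periods, valid in every word.  If j ≤ L is a period of the
--     prefix of length L + j that breaks at position L, and no b < j is a period of the
--     prefix of length L + 1 + b, then no b ∈ [1, L + 1] is a period of the prefix of
--     length L + 1 + b: a period j < b ≤ L yields the smaller period b - j, and the
--     period b = L + 1 would force u_L = u_{L+j} by a rotation argument modulo L + 1.
-- (3) Given N, either inrC(N) = N + 1, or we take the least period j ≤ N of the prefix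
--     at length N and its first break L ≥ N; then n = L + 1 works by (2).
module Submission where

open import Defs
open import Data.Bool using (Bool; true; false; if_then_else_)
import Data.Bool.Properties as BoolP
open import Data.Nat using (ℕ; zero; suc; _+_; _*_; _≤_; _<_; z≤n; s≤s; s≤s⁻¹; _<?_; NonZero; >-nonZero)
open import Data.Nat.Properties
open import Data.Nat.DivMod using (_%_; _/_; m<n⇒m%n≡m; [m+n]%n≡m%n; [m+kn]%n≡m%n; %-distribˡ-+; m%n%n≡m%n; m%n<n; m≡m%n+[m/n]*n)
open import Data.Nat.Induction using (<-rec)
open import Data.Nat.GeneralisedArithmetic using (iterate)
open import Data.Nat.Tactic.RingSolver using (solve-∀)
open import Data.Fin using (Fin; toℕ; fromℕ<)
import Data.Fin.Properties as FinP
open import Data.Vec using (Vec; lookup; _∷_; tail)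
import Data.Vec.Properties as VecP
open import Data.List using (List; length; map; applyUpTo; _∷_)
import Data.List as List
open import Data.List.Properties using (length-map; length-applyUpTo)
open import Data.List.Relation.Unary.All as All using (all?; _∷_)
open import Data.List.Relation.Unary.All.Properties.Core using (¬All⇒Any¬)
open import Data.List.Relation.Unary.AllPairs using (_∷_)
open import Data.List.Relation.Unary.Any using (here; there; index)
open import Data.List.Relation.Unary.Any.Properties using (lookup-index)
open import Data.List.Relation.Unary.Unique.Propositional using (Unique)
open import Data.List.Relation.Unary.Unique.Propositional.Properties using (map⁺; applyUpTo⁺₁)
open import Data.List.Relation.Binary.Subset.Propositional using (_⊆_)
open import Data.List.Membership.Propositional using (_∈_; _∉_; find)
open import Data.List.Membership.Propositional.Properties using (∈-lookup; ∈-map⁻; ∈-applyUpTo⁺; ∈-applyUpTo⁻)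
import Data.List.Membership.DecPropositional as DecMembership
open import Data.Product using (∃-syntax; _×_; _,_; proj₁; proj₂)
open import Data.Sum using (_⊎_; inj₁; inj₂)
open import Data.Empty using (⊥-elim)
open import Relation.Binary using (DecidableEquality; tri<; tri≈; tri>)
open import Relation.Binary.PropositionalEquality
open import Relation.Nullary using (¬_; Dec; yes; no; does; contradiction)
open import Relation.Nullary.Decidable using (map′; ¬?; decidable-stable)

vec≟ : ∀ {n} → DecidableEquality (Vec Bool n)
vec≟ = VecP.≡-dec BoolP._≟_

infix 4 _∈?_
_∈?_ : ∀ {n} (v : Vec Bool n) (vs : List (Vec Bool n)) → Dec (v ∈ vs)
_∈?_ = DecMembership._∈?_ vec≟

lookup-factor : ∀ u n i {t} (t<n : t < n) → lookup (factorAt u n i) (fromℕ< t<n) ≡ u (i + t)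
lookup-factor u n i t<n =
  trans (VecP.lookup∘tabulate _ (fromℕ< t<n)) (cong (λ s → u (i + s)) (FinP.toℕ-fromℕ< t<n))

factor-≡⁺ : ∀ u n i k → (∀ t → t < n → u (i + t) ≡ u (k + t)) → factorAt u n i ≡ factorAt u n k
factor-≡⁺ u n i k agree = VecP.tabulate-cong (λ t → agree (toℕ t) (FinP.toℕ<n t))

factor-≡⁻ : ∀ u n i k → factorAt u n i ≡ factorAt u n k → ∀ t → t < n → u (i + t) ≡ u (k + t)
factor-≡⁻ u n i k eq t t<n = begin
  u (i + t)                            ≡⟨ lookup-factor u n i t<n ⟨
  lookup (factorAt u n i) (fromℕ< t<n) ≡⟨ cong (λ v → lookup v (fromℕ< t<n)) eq ⟩
  lookup (factorAt u n k) (fromℕ< t<n) ≡⟨ lookup-factor u n k t<n ⟩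
  u (k + t)                            ∎
  where open ≡-Reasoning

factor-cons : ∀ u n i → factorAt u (suc n) i ≡ u i ∷ factorAt u n (suc i)
factor-cons u n i =
  cong₂ _∷_ (cong u (+-identityʳ i)) (VecP.tabulate-cong (λ t → cong u (+-suc i (toℕ t))))

factor-shorten : ∀ u {m n} i k → m ≤ n → factorAt u n i ≡ factorAt u n k → factorAt u m i ≡ factorAt u m k
factor-shorten u i k m≤n eq =
  factor-≡⁺ u _ i k (λ t t<m → factor-≡⁻ u _ i k eq t (<-≤-trans t<m m≤n))

-- p is a period of the prefix of length n + p, i.e. f_n(0) = f_n(p).
PrefixPeriod : Word → ℕ → ℕ → Set
PrefixPeriod u n p = ∀ t → t < n → u t ≡ u (p + t)

prefixPeriod? : ∀ u n p → Dec (PrefixPeriod u n p)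
prefixPeriod? u n p =
  map′ (factor-≡⁻ u n 0 p) (factor-≡⁺ u n 0 p) (vec≟ (factorAt u n 0) (factorAt u n p))

restrict : ∀ {u m n p} → m ≤ n → PrefixPeriod u n p → PrefixPeriod u m p
restrict m≤n per t t<m = per t (<-≤-trans t<m m≤n)

period-until-break : ∀ {u N j} s → PrefixPeriod u N j →
  (∀ s' → s' < s → u (N + s') ≡ u (j + (N + s'))) → PrefixPeriod u (N + s) j
period-until-break {N = N} s per holds t t<N+s with t <? N
... | yes t<N = per t t<N
... | no t≮N with s' , refl ← m≤n⇒∃[o]m+o≡n (≮⇒≥ t≮N) = holds s' (+-cancelˡ-< N s' s t<N+s)

unique-lookup-injective : ∀ {A : Set} {xs : List A} → Unique xs →
  ∀ i k → List.lookup xs i ≡ List.lookup xs k → i ≡ k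
unique-lookup-injective (_ ∷ _) Fin.zero Fin.zero _ = refl
unique-lookup-injective (fresh ∷ _) Fin.zero (Fin.suc k) eq = ⊥-elim (All.lookup fresh (∈-lookup k) eq)
unique-lookup-injective (fresh ∷ _) (Fin.suc i) Fin.zero eq = ⊥-elim (All.lookup fresh (∈-lookup i) (sym eq))
unique-lookup-injective (_ ∷ uniq) (Fin.suc i) (Fin.suc k) eq = cong Fin.suc (unique-lookup-injective uniq i k eq)

unique-⊆-length : ∀ {A : Set} {xs ys : List A} → Unique xs → xs ⊆ ys → length xs ≤ length ys
unique-⊆-length {xs = xs} {ys} uniq sub = FinP.injective⇒≤ {f = position} injective
  where
  position : Fin (length xs) → Fin (length ys)
  position i = index (sub (∈-lookup i))
  injective : ∀ {i k} → position i ≡ position k → i ≡ k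
  injective {i} {k} eq = unique-lookup-injective uniq i k (begin
    List.lookup xs i            ≡⟨ lookup-index (sub (∈-lookup i)) ⟩
    List.lookup ys (position i) ≡⟨ cong (List.lookup ys) eq ⟩
    List.lookup ys (position k) ≡⟨ lookup-index (sub (∈-lookup k)) ⟨
    List.lookup xs k            ∎)
    where open ≡-Reasoning

least-or-none : ∀ {P : ℕ → Set} → (∀ i → Dec (P i)) → ∀ m →
  (∀ i → i < m → ¬ P i) ⊎ (∃[ i ] (i < m × P i × (∀ k → k < i → ¬ P k)))
least-or-none P? zero = inj₁ (λ _ ())
least-or-none P? (suc m) with least-or-none P? m
... | inj₂ (i , i<m , Pi , least) = inj₂ (i , m<n⇒m<1+n i<m , Pi , least)
... | inj₁ none with P? m
...   | yes Pm = inj₂ (m , ≤-refl , Pm , none)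
...   | no ¬Pm = inj₁ none-below-suc
  where
  none-below-suc : ∀ i → i < suc m → ¬ _
  none-below-suc i i<1+m with m≤n⇒m<n∨m≡n (s≤s⁻¹ i<1+m)
  ... | inj₁ i<m = none i i<m
  ... | inj₂ refl = ¬Pm

distinct-≤-complexity : ∀ u {n m k} → HasNFactors u n k → DistinctPrefixFactors u n m → m ≤ k
distinct-≤-complexity u {n} {m} {k} (ws , _ , length-ws , spec) distinct =
  subst₂ _≤_ (length-applyUpTo f m) length-ws (unique-⊆-length unique sub)
  where
  f : ℕ → Vec Bool n
  f = factorAt u n
  unique : Unique (applyUpTo f m)
  unique = applyUpTo⁺₁ f m (λ i<j j<m → distinct _ _ i<j j<m)
  sub : applyUpTo f m ⊆ ws
  sub w∈ with i , _ , refl ← ∈-applyUpTo⁻ f w∈ = proj₂ (spec (f i)) (i , refl)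

left-extension : ∀ u {n} {w : Vec Bool n} → Recurrent u → IsFactor u w → ∃[ a ] IsFactor u (a ∷ w)
left-extension u {n} recurrent (i , refl) with recurrent n i 1
... | suc p , _ , occurrence = u p , p , trans (factor-cons u n p) (cong (u p ∷_) occurrence)

left-special-from : ∀ u {n} {w : Vec Bool n} {a b} → a ≢ b →
  IsFactor u (a ∷ w) → IsFactor u (b ∷ w) → LeftSpecial u w
left-special-from _ {a = false} {false} a≢b _ _ = ⊥-elim (a≢b refl)
left-special-from _ {a = false} {true} _ fw tw = fw , tw
left-special-from _ {a = true} {false} _ tw fw = fw , tw
left-special-from _ {a = true} {true} a≢b _ _ = ⊥-elim (a≢b refl)

-- A recurrent word with k factors of length n and k + 1 factors of length n + 1 has
-- at most one left special factor of length n: two of them, w ≠ w', would give the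
-- k + 2 distinct factors 1w, 1w' and a chosen left extension of each length-n factor
-- (writing 0, 1 for false, true; the chosen extension of w and w' is 0w, 0w').
left-special-unique : ∀ u {n k} → Recurrent u → HasNFactors u n k → HasNFactors u (suc n) (suc k) →
  ∀ {w w' : Vec Bool n} → LeftSpecial u w → LeftSpecial u w' → w ≡ w'
left-special-unique u {n} {k} recurrent (ws , unique-ws , length-ws , spec-ws)
                    (vs , _ , length-vs , spec-vs) {w} {w'} (fw , tw) (fw' , tw') with vec≟ w w'
... | yes w≡w' = w≡w'
... | no w≢w' = contradiction too-many 1+n≰n
  where
  extend : Vec Bool n → Vec Bool (suc n)
  extend x = (if does (false ∷ x ∈? vs) then false else true) ∷ x

  extend-∈ : ∀ {x} → x ∈ ws → extend x ∈ vs
  extend-∈ {x} x∈ws with false ∷ x ∈? vs | left-extension u recurrent (proj₁ (spec-ws x) x∈ws)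
  ... | yes 0x∈ | _ = 0x∈
  ... | no 0x∉ | false , 0x = ⊥-elim (0x∉ (proj₂ (spec-vs _) 0x))
  ... | no _ | true , 1x = proj₂ (spec-vs _) 1x

  extend-special : ∀ {x} → IsFactor u (false ∷ x) → extend x ≡ false ∷ x
  extend-special {x} 0x with false ∷ x ∈? vs
  ... | yes _ = refl
  ... | no 0x∉ = ⊥-elim (0x∉ (proj₂ (spec-vs _) 0x))

  true-∉ : ∀ {x} → IsFactor u (false ∷ x) → true ∷ x ∉ map extend ws
  true-∉ {x} 0x 1x∈ with y , _ , 1x≡ ← ∈-map⁻ extend 1x∈ with cong tail 1x≡
  ... | refl = contradiction (trans 1x≡ (extend-special 0x)) λ ()

  candidates : List (Vec Bool (suc n))
  candidates = (true ∷ w) ∷ (true ∷ w') ∷ map extend ws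

  candidates-unique : Unique candidates
  candidates-unique =
    ((λ eq → w≢w' (cong tail eq)) ∷ All.tabulate (λ y∈ eq → true-∉ fw (subst (_∈ _) (sym eq) y∈)))
    ∷ All.tabulate (λ y∈ eq → true-∉ fw' (subst (_∈ _) (sym eq) y∈))
    ∷ map⁺ (cong tail) unique-ws

  candidates-⊆ : candidates ⊆ vs
  candidates-⊆ (here refl) = proj₂ (spec-vs _) tw
  candidates-⊆ (there (here refl)) = proj₂ (spec-vs _) tw'
  candidates-⊆ (there (there y∈)) with x , x∈ , refl ← ∈-map⁻ extend y∈ = extend-∈ x∈

  too-many : suc (suc k) ≤ suc k
  too-many = subst₂ _≤_ (cong (λ l → suc (suc l)) (trans (length-map extend ws) length-ws)) length-vs
                        (unique-⊆-length candidates-unique candidates-⊆)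

-- In a standard Sturmian word the first repetition among f_n(0), f_n(1), ... is a
-- return of the prefix f_n(0): a first repetition f_n(i+1) = f_n(j+1) with u_i ≠ u_j
-- makes f_n(i+1) left special, hence equal to the (left special) prefix f_n(0).
distinct-unless-prefix-returns : ∀ u → Sturmian u → Standard u → ∀ {n m} →
  (∀ b → 0 < b → b < m → factorAt u n 0 ≢ factorAt u n b) → DistinctPrefixFactors u n m
distinct-unless-prefix-returns u (recurrent , complexity) standard {n} {m} prefix-fresh = distinct
  where
  distinct : DistinctPrefixFactors u n m
  distinct zero j 0<j j<m = prefix-fresh j 0<j j<m
  distinct (suc i) (suc j) i<j j<m eq with u i BoolP.≟ u j
  ... | yes same = distinct i j (s≤s⁻¹ i<j) (<-trans (n<1+n j) j<m) earlier
    where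
    earlier : factorAt u n i ≡ factorAt u n j
    earlier = factor-shorten u i j (n≤1+n n)
      (trans (factor-cons u n i) (trans (cong₂ _∷_ same eq) (sym (factor-cons u n j))))
  ... | no differ = prefix-fresh (suc i) (s≤s z≤n) (<-trans i<j j<m)
      (left-special-unique u recurrent (complexity n) (complexity (suc n)) (standard n) special)
    where
    special : LeftSpecial u (factorAt u n (suc i))
    special = left-special-from u differ (i , factor-cons u n i)
                                       (j , trans (factor-cons u n j) (cong (u j ∷_) (sym eq)))

inrC-from-no-period : ∀ u {n} → Sturmian u → Standard u →
  (∀ p → 0 < p → p ≤ n → ¬ PrefixPeriod u n p) → InrC≡ u n (suc n)
inrC-from-no-period u {n} sturmian standard no-period =
  distinct-unless-prefix-returns u sturmian standard
    (λ p 0<p p<1+n eq → no-period p 0<p (s≤s⁻¹ p<1+n) (factor-≡⁻ u n 0 p eq)) ,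
  λ m distinct → distinct-≤-complexity u (proj₂ sturmian n) distinct

periodic-factor : ∀ u N p B → (∀ s → s < B → u (N + s) ≡ u (p + (N + s))) →
  ∀ r k → r + k * p ≤ B → factorAt u p (N + (r + k * p)) ≡ factorAt u p (N + r)
periodic-factor u N p B periodic r zero _ = cong (λ x → factorAt u p (N + x)) (+-identityʳ r)
periodic-factor u N p B periodic r (suc k) bound =
  trans (factor-≡⁺ u p _ _ one-period) (periodic-factor u N p B periodic r k (≤-trans shorter bound))
  where
  shorter : r + k * p ≤ r + suc k * p
  shorter = +-monoʳ-≤ r (m≤n+m (k * p) p)
  regroup : ∀ N r k p t → N + (r + k * p) + t ≡ N + (r + k * p + t)
  regroup = solve-∀
  shift : ∀ N r k p t → p + (N + (r + k * p + t)) ≡ N + (r + suc k * p) + t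
  shift = solve-∀
  one-more : ∀ r k p → r + suc k * p ≡ r + k * p + p
  one-more = solve-∀
  in-range : ∀ t → t < p → r + k * p + t < B
  in-range t t<p = <-≤-trans (+-monoʳ-< (r + k * p) t<p)
                             (subst (_≤ B) (one-more r k p) bound)
  one-period : ∀ t → t < p → u (N + (r + suc k * p) + t) ≡ u (N + (r + k * p) + t)
  one-period t t<p = sym (begin
    u (N + (r + k * p) + t)           ≡⟨ cong u (regroup N r k p t) ⟩
    u (N + (r + k * p + t))           ≡⟨ periodic (r + k * p + t) (in-range t t<p) ⟩
    u (p + (N + (r + k * p + t)))     ≡⟨ cong u (shift N r k p t) ⟩
    u (N + (r + suc k * p) + t)       ∎)
    where open ≡-Reasoning

window : Word → ℕ → (p : ℕ) → List (Vec Bool p)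
window u N p = applyUpTo (λ t → factorAt u p (N + t)) p

-- Otherwise some
-- factor outside the window at N, recurring at a position N + r, would reduce to a
-- factor of the window by periodicity.
first-break : ∀ u {p} → Recurrent u → HasNFactors u p (suc p) → 0 < p → ∀ N →
  ∃[ s ] (u (N + s) ≢ u (p + (N + s)) × (∀ s' → s' < s → u (N + s') ≡ u (p + (N + s'))))
first-break u {p} recurrent (ws , unique-ws , length-ws , spec) 0<p N
  with all? (_∈? window u N p) ws
... | yes all-in = contradiction (subst₂ _≤_ length-ws (length-applyUpTo _ p)
                                   (unique-⊆-length unique-ws (All.lookup all-in))) 1+n≰n
... | no ¬all-in with find (¬All⇒Any¬ (_∈? window u N p) ws ¬all-in)
...   | w , w∈ws , w∉window with proj₁ (spec w) w∈ws
...     | i , occurrence with recurrent p i N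
...       | q , N≤q , recurrence with m≤n⇒∃[o]m+o≡n N≤q
...         | r , refl with least-or-none (λ s → ¬? (u (N + s) BoolP.≟ u (p + (N + s)))) r
...           | inj₂ (s , _ , breaks , least) =
  s , breaks , λ s' s'<s → decidable-stable (u (N + s') BoolP.≟ u (p + (N + s'))) (least s' s'<s)
...           | inj₁ none =
  contradiction (subst (_∈ window u N p) reduces (∈-applyUpTo⁺ _ (m%n<n r p))) w∉window
  where
  instance
    p≢0 : NonZero p
    p≢0 = >-nonZero 0<p
  periodic : ∀ s → s < r → u (N + s) ≡ u (p + (N + s))
  periodic s s<r = decidable-stable (u (N + s) BoolP.≟ u (p + (N + s))) (none s s<r)
  division : r ≡ r % p + r / p * p
  division = m≡m%n+[m/n]*n r p
  reduces : factorAt u p (N + r % p) ≡ w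
  reduces = begin
    factorAt u p (N + r % p)               ≡⟨ periodic-factor u N p r periodic (r % p) (r / p) (≤-reflexive (sym division)) ⟨
    factorAt u p (N + (r % p + r / p * p)) ≡⟨ cong (λ x → factorAt u p (N + x)) division ⟨
    factorAt u p (N + r)                   ≡⟨ recurrence ⟩
    factorAt u p i                         ≡⟨ occurrence ⟩
    w                                      ∎
    where open ≡-Reasoning

period-difference : ∀ {u j d L} → 0 < j → j + d ≤ L →
  PrefixPeriod u L j → PrefixPeriod u (suc L) (j + d) → PrefixPeriod u (suc L) d
period-difference {u} {j} {d} {L} 0<j j+d≤L per-j per-jd t t<1+L with t <? j
... | yes t<j = begin
  u t             ≡⟨ per-jd t (≤-trans t<j (≤-trans (m≤m+n j d) (m≤n⇒m≤1+n j+d≤L))) ⟩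
  u (j + d + t)   ≡⟨ cong u (+-assoc j d t) ⟩
  u (j + (d + t)) ≡⟨ per-j (d + t) (<-≤-trans (+-monoʳ-< d t<j) (subst (_≤ L) (+-comm j d) j+d≤L)) ⟨
  u (d + t)       ∎
  where open ≡-Reasoning
... | no t≮j with s , refl ← m≤n⇒∃[o]m+o≡n (≮⇒≥ t≮j) = begin
  u (j + s)       ≡⟨ per-j s (s≤s⁻¹ (<-≤-trans (s≤s (m<n+m s 0<j)) t<1+L)) ⟨
  u s             ≡⟨ per-jd s (<-trans (m<n+m s 0<j) t<1+L) ⟩
  u (j + d + s)   ≡⟨ cong u (trans (cong (_+ s) (+-comm j d)) (+-assoc d j s)) ⟩
  u (d + (j + s)) ∎
  where open ≡-Reasoning

reduce-mod : ∀ {u m} .{{_ : NonZero m}} → PrefixPeriod u m m → ∀ y → y < m + m → u y ≡ u (y % m)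
reduce-mod {u} {m} per y y<2m with y <? m
... | yes y<m = cong u (sym (m<n⇒m%n≡m y<m))
... | no y≮m with e , refl ← m≤n⇒∃[o]m+o≡n (≮⇒≥ y≮m) =
  trans (sym (per e e<m)) (cong u (sym (begin
    (m + e) % m ≡⟨ cong (_% m) (+-comm m e) ⟩
    (e + m) % m ≡⟨ [m+n]%n≡m%n e m ⟩
    e % m       ≡⟨ m<n⇒m%n≡m e<m ⟩
    e           ∎)))
  where
  open ≡-Reasoning
  e<m : e < m
  e<m = +-cancelˡ-< m e m y<2m

orbit-invariant : ∀ {A : Set} (v : ℕ → A) (g : ℕ → ℕ) {m e} → (∀ x → g x < m) →
  (∀ x → x < m → x ≢ e → v (g x) ≡ v x) → ∀ k x → x < m → iterate g x k ≡ e → v x ≡ v e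
orbit-invariant v g g<m step zero x _ refl = refl
orbit-invariant v g {e = e} g<m step (suc k) x x<m reaches with x ≟ e
... | yes refl = refl
... | no x≢e = trans (sym (step x x<m x≢e)) (orbit-invariant v g g<m step k (g x) (g<m x) reaches)

%-absorbʳ : ∀ a b m .{{_ : NonZero m}} → (a + b % m) % m ≡ (a + b) % m
%-absorbʳ a b m = begin
  (a + b % m) % m         ≡⟨ %-distribˡ-+ a (b % m) m ⟩
  (a % m + b % m % m) % m ≡⟨ cong (λ z → (a % m + z) % m) (m%n%n≡m%n b m) ⟩
  (a % m + b % m) % m     ≡⟨ %-distribˡ-+ a b m ⟨
  (a + b) % m             ∎
  where open ≡-Reasoning

iterate-rotation : ∀ m .{{_ : NonZero m}} j {x} → x < m → ∀ k →
  iterate (λ y → (j + y) % m) x k ≡ (k * j + x) % m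
iterate-rotation m j x<m zero = sym (m<n⇒m%n≡m x<m)
iterate-rotation m j {x} x<m (suc k) = begin
  iterate (λ y → (j + y) % m) ((j + x) % m) k ≡⟨ iterate-rotation m j (m%n<n (j + x) m) k ⟩
  (k * j + (j + x) % m) % m                   ≡⟨ %-absorbʳ (k * j) (j + x) m ⟩
  (k * j + (j + x)) % m                       ≡⟨ cong (_% m) (regroup k j x) ⟩
  (suc k * j + x) % m                         ∎
  where
  open ≡-Reasoning
  regroup : ∀ k j x → k * j + (j + x) ≡ suc k * j + x
  regroup = solve-∀

-- Indeed u is invariant under the rotation
-- x ↦ x + j of [0, L] except at L, and the orbit of L + j mod (L + 1) returns to L.
square-period : ∀ {u j L} → j ≤ L → PrefixPeriod u L j → PrefixPeriod u (suc L) (suc L) → u L ≡ u (j + L)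
square-period {u} {j} {L} j≤L per-j per-square = begin
  u L          ≡⟨ orbit-invariant u rotate (λ x → m%n<n (j + x) (suc L)) step L (rotate L)
                                 (m%n<n (j + L) (suc L)) returns ⟨
  u (rotate L) ≡⟨ reduce-mod per-square (j + L) (+-mono-< (s≤s j≤L) (n<1+n L)) ⟨
  u (j + L)    ∎
  where
  open ≡-Reasoning
  rotate : ℕ → ℕ
  rotate y = (j + y) % suc L
  step : ∀ x → x < suc L → x ≢ L → u (rotate x) ≡ u x
  step x x<1+L x≢L = sym (trans (per-j x (≤∧≢⇒< (s≤s⁻¹ x<1+L) x≢L))
                                (reduce-mod per-square (j + x) (+-mono-< (s≤s j≤L) x<1+L)))
  full-turn : ∀ L j → suc L * j + L ≡ L + j * suc L
  full-turn = solve-∀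
  returns : iterate rotate (rotate L) L ≡ L
  returns = begin
    iterate rotate L (suc L)   ≡⟨ iterate-rotation (suc L) j (n<1+n L) (suc L) ⟩
    (suc L * j + L) % suc L    ≡⟨ cong (_% suc L) (full-turn L j) ⟩
    (L + j * suc L) % suc L    ≡⟨ [m+kn]%n≡m%n L j (suc L) ⟩
    L % suc L                  ≡⟨ m<n⇒m%n≡m (n<1+n L) ⟩
    L                          ∎

no-period-after-break : ∀ {u j L} → 0 < j → j ≤ L →
  (∀ b → 0 < b → b < j → ¬ PrefixPeriod u (suc L) b) → PrefixPeriod u L j → u L ≢ u (j + L) →
  ∀ b → 0 < b → b ≤ suc L → ¬ PrefixPeriod u (suc L) b
no-period-after-break {u} {j} {L} 0<j j≤L shorter per-j breaks = <-rec Excluded excluded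
  where
  Excluded : ℕ → Set
  Excluded b = 0 < b → b ≤ suc L → ¬ PrefixPeriod u (suc L) b
  excluded : ∀ b → (∀ {d} → d < b → Excluded d) → Excluded b
  excluded b smaller 0<b b≤1+L per-b with <-cmp b j
  ... | tri< b<j _ _ = shorter b 0<b b<j per-b
  ... | tri≈ _ refl _ = breaks (per-b L ≤-refl)
  ... | tri> _ _ j<b with m≤n⇒m<n∨m≡n b≤1+L
  ...   | inj₂ refl = breaks (square-period j≤L per-j per-b)
  ...   | inj₁ b<1+L with d , refl ← m≤n⇒∃[o]m+o≡n (<⇒≤ j<b) =
    smaller (m<n+m d 0<j) 0<d (≤-trans (m≤n+m d j) b≤1+L)
            (period-difference 0<j (s≤s⁻¹ b<1+L) per-j per-b)
    where
    0<d : 0 < d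
    0<d = +-cancelˡ-< j 0 d (subst (_< j + d) (sym (+-identityʳ j)) j<b)

corollary16 : (u : Word) → Sturmian u → Standard u →
    ∀ (N : ℕ) → ∃[ n ] (N ≤ n × InrC≡ u n (suc n))
corollary16 u sturmian@(recurrent , complexity) standard N
  with least-or-none (λ i → prefixPeriod? u N (suc i)) N
... | inj₁ none = N , ≤-refl , inrC-from-no-period u sturmian standard no-period
  where
  no-period : ∀ p → 0 < p → p ≤ N → ¬ PrefixPeriod u N p
  no-period (suc i) _ p≤N = none i p≤N
... | inj₂ (i , i<N , per-N , least) with first-break u recurrent (complexity (suc i)) (s≤s z≤n) N
...   | s , breaks , holds =
  suc (N + s) , m≤n⇒m≤1+n N≤L ,
  inrC-from-no-period u sturmian standard
    (no-period-after-break (s≤s z≤n) (≤-trans i<N N≤L) shorter (period-until-break s per-N holds) breaks)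
  where
  N≤L : N ≤ N + s
  N≤L = m≤m+n N s
  shorter : ∀ b → 0 < b → b < suc i → ¬ PrefixPeriod u (suc (N + s)) b
  shorter (suc b) _ b<j per = least b (s≤s⁻¹ b<j) (restrict (m≤n⇒m≤1+n N≤L) per)
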